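{- Let $Q$ be a graph and $d$ a bond of $Q$ such that $Q$ is 3-connected along $d$, and let $L$ and $R$ be the edge sets of the left and right sides of $d$. If both $Q[L]$ and $Q[R]$ are triangles, then $(Q,d)$ is (isomorphic to) the special prism or has a proper special contraction minor that is (isomorphic to) the special $K_4$.
   Context: All graphs are simple. For a bond $d$ of a connected graph $Q$, $Q-d$ has two components, the sides of $d$; $L$ and $R$ are their edge sets. For an edge set $Z$, $Q[Z]$ is the subgraph whose edges are $Z$ and whose vertices are the endvertices of edges in $Z$. $Q$ is 3-connected along $d$ if $Q$ is 2-connected and there are no vertices $x$ on the left side and $y$ on the right side with $Q-x-y$ disconnected. A special contraction minor of $(Q,d)$ is a pair $(Q',d')$ where $Q'$ is obtained from $Q$ by contracting edges not in $d$ (removing loops and reducing parallel classes to one edge) and $d'=d\cap E(Q')$; it is proper if it differs from $(Q,d)$. The special $K_4$ is $K_4$ together with a bond of size 4; the special prism is the prism (two disjoint triangles joined by a perfect matching) together with the bond consisting of the three matching edges. -}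

module Defs where

open import Data.Nat using (ℕ; _≤_; _+_)
open import Data.Nat.Base using (_<ᵇ_; _≡ᵇ_)
open import Data.Bool using (Bool; true; false; _∧_; _∨_; not; _xor_; T)
open import Data.Fin using (Fin; toℕ; _≟_)
open import Data.Product using (Σ; ∃; _×_; _,_; proj₁; proj₂; swap)
open import Data.Sum using (_⊎_)
open import Relation.Nullary using (¬_; ⌊_⌋)
open import Relation.Binary.PropositionalEquality using (_≡_; _≢_)
open import Relation.Binary.Construct.Closure.ReflexiveTransitive using (Star)
open import Function.Bundles using (_⇔_; _↔_; Inverse)

record Graph : Set where
  field
    n       : ℕ
    adj     : Fin n → Fin n → Bool
    adj-sym : ∀ u v → adj u v ≡ adj v u
    adj-irr : ∀ u → adj u u ≡ false

open Graph public

-- Edge sets of G are represented by (symmetric) Bool-valued relations on vertices.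
EdgeSet : Graph → Set
EdgeSet G = Fin (n G) → Fin (n G) → Bool

Adj : (G : Graph) → Fin (n G) → Fin (n G) → Set
Adj G u v = adj G u v ≡ true

Connected : Graph → Set
Connected G = ∀ u v → Star (Adj G) u v

TwoConnected : Graph → Set
TwoConnected G =
  3 ≤ n G × Connected G ×
  (∀ x u v → u ≢ x → v ≢ x →
     Star (λ a b → Adj G a b × a ≢ x × b ≢ x) u v)

IsCut : (G : Graph) → EdgeSet G → Set
IsCut G d = Σ (Fin (n G) → Bool) λ X →
  ∀ u v → d u v ≡ (adj G u v ∧ (X u xor X v))

NonEmptyES : (G : Graph) → EdgeSet G → Set
NonEmptyES G d = Σ (Fin (n G)) λ u → Σ (Fin (n G)) λ v → d u v ≡ true

IsBond : (G : Graph) → EdgeSet G → Set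
IsBond G d =
  IsCut G d × NonEmptyES G d ×
  (∀ d' → IsCut G d' → NonEmptyES G d' →
     (∀ u v → d' u v ≡ true → d u v ≡ true) →
     ∀ u v → d u v ≡ true → d' u v ≡ true)

MinusD : (G : Graph) → EdgeSet G → Fin (n G) → Fin (n G) → Set
MinusD G d u v = adj G u v ≡ true × d u v ≡ false

SameSide : (G : Graph) → EdgeSet G → Fin (n G) → Fin (n G) → Set
SameSide G d = Star (MinusD G d)

ThreeConnAlong : (G : Graph) → EdgeSet G → Set
ThreeConnAlong G d =
  TwoConnected G ×
  ¬ (Σ (Fin (n G)) λ x → Σ (Fin (n G)) λ y → ¬ SameSide G d x y ×
       Σ (Fin (n G)) λ u → Σ (Fin (n G)) λ v →
         u ≢ x × u ≢ y × v ≢ x × v ≢ y ×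
         ¬ Star (λ a b → Adj G a b × a ≢ x × a ≢ y × b ≢ x × b ≢ y) u v)

-- the edge set of the side containing v (edges of G - d inside v's component)
SideEdge : (G : Graph) → EdgeSet G → Fin (n G) → Fin (n G) → Fin (n G) → Set
SideEdge G d v a b = SameSide G d v a × MinusD G d a b

SideIsTriangle : (G : Graph) → EdgeSet G → Fin (n G) → Set
SideIsTriangle G d v =
  Σ (Fin (n G)) λ x → Σ (Fin (n G)) λ y → Σ (Fin (n G)) λ z →
    x ≢ y × y ≢ z × x ≢ z ×
    (∀ a b → SideEdge G d v a b ⇔
       (a ≢ b × (a ≡ x ⊎ a ≡ y ⊎ a ≡ z) × (b ≡ x ⊎ b ≡ y ⊎ b ≡ z)))

-- Special K4: K4 on Fin 4 with the bond of size 4 between {0,1} and {2,3}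

k4adj : Fin 4 → Fin 4 → Bool
k4adj a b = not ⌊ a ≟ b ⌋

k4bond : Fin 4 → Fin 4 → Bool
k4bond a b = (toℕ a <ᵇ 2) xor (toℕ b <ᵇ 2)

-- Special prism on Fin 6: triangles {0,1,2}, {3,4,5}, matching i -- i+3 (the bond)
prismBond : Fin 6 → Fin 6 → Bool
prismBond a b = ((toℕ a + 3) ≡ᵇ toℕ b) ∨ ((toℕ b + 3) ≡ᵇ toℕ a)

prismAdj : Fin 6 → Fin 6 → Bool
prismAdj a b =
  (not ((toℕ a <ᵇ 3) xor (toℕ b <ᵇ 3)) ∧ not ⌊ a ≟ b ⌋) ∨ prismBond a b

IsoSpecialPrism : (G : Graph) → EdgeSet G → Set
IsoSpecialPrism G d = Σ (Fin (n G) ↔ Fin 6) λ f →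
  ∀ u v → adj G u v ≡ prismAdj (Inverse.to f u) (Inverse.to f v)
        × d u v ≡ prismBond (Inverse.to f u) (Inverse.to f v)

-- Vertices of Q' are the classes (fibres of φ) of a partition of V(Q) into
-- sets each connected by edges not in d (the contracted edges).  Q' has an
-- edge between distinct classes iff Q has an edge between them; each such
-- parallel class is reduced to one chosen representative edge of Q (rep),
-- and d' = d ∩ E(Q') consists of those classes whose representative is in d.

MinorAdj : (G : Graph) {m : ℕ} → (Fin (n G) → Fin m) → Fin m → Fin m → Set
MinorAdj G φ a b = a ≢ b ×
  Σ (Fin (n G)) λ u → Σ (Fin (n G)) λ v → φ u ≡ a × φ v ≡ b × Adj G u v

record SpecialContraction (G : Graph) (d : EdgeSet G) : Set where
  field
    m          : ℕ
    φ          : Fin (n G) → Fin m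
    φ-surj     : ∀ a → Σ (Fin (n G)) λ u → φ u ≡ a
    fibre-conn : ∀ u v → φ u ≡ φ v →
                 Star (λ x y → MinusD G d x y × φ x ≡ φ u × φ y ≡ φ u) u v
    rep        : Fin m → Fin m → Fin (n G) × Fin (n G)
    rep-ok     : ∀ a b → MinorAdj G φ a b →
                 φ (proj₁ (rep a b)) ≡ a × φ (proj₂ (rep a b)) ≡ b
                 × Adj G (proj₁ (rep a b)) (proj₂ (rep a b))
    rep-sym    : ∀ a b → MinorAdj G φ a b → rep b a ≡ swap (rep a b)

  Adj' : Fin m → Fin m → Set
  Adj' = MinorAdj G φ

  Bond' : Fin m → Fin m → Set
  Bond' a b = Adj' a b × d (proj₁ (rep a b)) (proj₂ (rep a b)) ≡ true

  -- proper: at least one edge was contracted (φ is not injective)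
  Proper : Set
  Proper = Σ (Fin (n G)) λ u → Σ (Fin (n G)) λ v → u ≢ v × φ u ≡ φ v

  IsoSpecialK4 : Set
  IsoSpecialK4 = Σ (Fin m ↔ Fin 4) λ g →
    ∀ a b → (Adj' a b ⇔ T (k4adj (Inverse.to g a) (Inverse.to g b)))
          × (Bond' a b ⇔ T (k4bond (Inverse.to g a) (Inverse.to g b)))

-- Both sides of d are triangles, p on the left and q on the right.  By
-- minimality of the bond, every edge of d has exactly one end on each
-- triangle, so the six triangle vertices are closed under adjacency and are
-- all of G; the graph is then determined by the 3×3 matrix of edges between p
-- and q, all of which are in d.  3-connectivity along d says that deleting any
-- row and any column of that matrix leaves a nonzero 2×2 matrix, and such a
-- matrix is either a permutation matrix, which gives the special prism, or has
-- a one whose row, column and complementary 2×2 block all contain further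
-- ones; contracting one edge of each triangle then gives the special K4.
module Submission where

open import Defs
open import Data.Product using (Σ; _×_)
open import Data.Sum using (_⊎_)

open import Data.Bool using (Bool; true; false; not; _∧_; _xor_; T; if_then_else_)
open import Data.Bool.Properties
  using (T?; T-≡; T-not-≡; ∧-conicalˡ; ∧-conicalʳ; ∧-identityʳ; xor-comm; xor-same; xor-inverseˡ; ¬-not)
  renaming (_≟_ to _≟ᴮ_)
open import Data.Fin using (Fin; _≟_; toℕ; join; splitAt)
open import Data.Fin.Patterns using (0F; 1F; 2F; 3F)
open import Data.Fin.Properties using (any?; all?; splitAt-join; +↔⊎)
open import Data.Nat using (zero; suc; _<ᵇ_)
open import Data.Product using (∃; ∃₂; _,_; proj₁; proj₂)
open import Data.Sum using (inj₁; inj₂; [_,_]′; map₂)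
open import Data.Unit using (tt)
open import Data.Vec using (Vec; []; _∷_; lookup; tabulate)
open import Data.Vec.Properties using (lookup∘tabulate)
open import Function using (_∘_; id; _↔_; _⇔_; Inverse; Equivalence; mk↔ₛ′; mk⇔; Injective)
open import Function.Construct.Composition using (_↔-∘_)
open import Function.Construct.Identity using (↔-id)
open import Function.Construct.Symmetry using (↔-sym)
open import Level using (0ℓ)
open import Relation.Binary.PropositionalEquality
  using (_≡_; _≢_; refl; sym; trans; cong; cong₂; subst; subst₂; ≢-sym; module ≡-Reasoning)
open import Relation.Binary.Construct.Closure.ReflexiveTransitive using (Star; ε; _◅_; fold)
open import Relation.Nullary using (Dec; yes; no; ¬_; ¬?; does; ⌊_⌋; contradiction)
open import Relation.Nullary.Decidable
  using (map′; _×-dec_; _⊎-dec_; _→-dec_; toWitness; toWitnessFalse; fromWitness; fromWitnessFalse;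
         decidable-stable; dec-true; dec-false)
open import Relation.Unary using (Pred; Decidable)

Exhaustible : Set → Set₁
Exhaustible A = ∀ {P : Pred A 0ℓ} → Decidable P → Dec (∀ x → P x)

Bool-exhaustible : Exhaustible Bool
Bool-exhaustible P? =
  map′ (λ { (t , f) true → t ; (t , f) false → f }) (λ h → h true , h false)
       (P? true ×-dec P? false)

Vec-exhaustible : ∀ {A} → Exhaustible A → ∀ n → Exhaustible (Vec A n)
Vec-exhaustible A? zero    P? = map′ (λ { p [] → p }) (λ h → h []) (P? [])
Vec-exhaustible A? (suc n) P? =
  map′ (λ { h (x ∷ xs) → h x xs }) (λ h x xs → h (x ∷ xs))
       (A? λ x → Vec-exhaustible A? n λ xs → P? (x ∷ xs))

infix 4 _≢?_
_≢?_ : ∀ {n} (i j : Fin n) → Dec (i ≢ j)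
i ≢? j = ¬? (i ≟ j)

avoid-two : ∀ (a b : Fin 3) → ∃ λ k → k ≢ a × k ≢ b
avoid-two = toWitness {a? = all? λ a → all? λ b → any? λ k → k ≢? a ×-dec k ≢? b} tt

xor≡true⇒≢ : ∀ {x y} → x xor y ≡ true → x ≢ y
xor≡true⇒≢ {x} x⊕x≡true refl = contradiction (trans (sym x⊕x≡true) (xor-same x)) λ ()

xor≡false⇒≡ : ∀ x y → x xor y ≡ false → x ≡ y
xor≡false⇒≡ true  true  _  = refl
xor≡false⇒≡ true  false ()
xor≡false⇒≡ false true  ()
xor≡false⇒≡ false false _  = refl

≢⇒xor≡true : ∀ {x y} → x ≢ y → x xor y ≡ true
≢⇒xor≡true {y = y} x≢y = subst (λ x → x xor y ≡ true) (sym (¬-not x≢y)) (xor-inverseˡ y)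

preserved-along : ∀ {A : Set} {R : A → A → Set} (P : A → Set) →
                  (∀ {a b} → R a b → P a → P b) → ∀ {a b} → Star R a b → P a → P b
preserved-along P step = fold (λ a b → P a → P b) (λ r k → k ∘ step r) id

ε-or-step : ∀ {A : Set} {R : A → A → Set} {a b} → Star R a b → a ≡ b ⊎ ∃ (R a)
ε-or-step ε       = inj₁ refl
ε-or-step (r ◅ _) = inj₂ (_ , r)

map₂-inverse : ∀ {A B C : Set} {f : B → C} {g : C → B} → (∀ c → f (g c) ≡ c) →
               ∀ (x : A ⊎ C) → map₂ f (map₂ g x) ≡ x
map₂-inverse f∘g≡id (inj₁ a) = refl
map₂-inverse f∘g≡id (inj₂ c) = cong inj₂ (f∘g≡id c)

Matrix₃ : Set
Matrix₃ = Vec (Vec Bool 3) 3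

_⟨_,_⟩ : Matrix₃ → Fin 3 → Fin 3 → Bool
M ⟨ i , j ⟩ = lookup (lookup M i) j

NonzeroMinor : Matrix₃ → Fin 3 → Fin 3 → Set
NonzeroMinor M x y = ∃₂ λ i j → i ≢ x × j ≢ y × T (M ⟨ i , j ⟩)

MinorsNonzero : Matrix₃ → Set
MinorsNonzero M = ∀ x y → NonzeroMinor M x y

UniqueInRow : Matrix₃ → Fin 3 → Set
UniqueInRow M i = ∃ λ j → T (M ⟨ i , j ⟩) × ∀ k → T (M ⟨ i , k ⟩) → k ≡ j

UniqueInColumn : Matrix₃ → Fin 3 → Set
UniqueInColumn M j = ∃ λ i → T (M ⟨ i , j ⟩) × ∀ k → T (M ⟨ k , j ⟩) → k ≡ i

IsPermutationMatrix : Matrix₃ → Set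
IsPermutationMatrix M = (∀ i → UniqueInRow M i) × (∀ j → UniqueInColumn M j)

-- Contracting all rows but row and all columns but col leaves an all-ones
-- 2×2 matrix.
record K4Pattern (M : Matrix₃) : Set where
  field
    row col      : Fin 3
    corner       : T (M ⟨ row , col ⟩)
    row′         : Fin 3
    row′≢row     : row′ ≢ row
    below        : T (M ⟨ row′ , col ⟩)
    col′         : Fin 3
    col′≢col     : col′ ≢ col
    beside       : T (M ⟨ row , col′ ⟩)
    row″ col″    : Fin 3
    row″≢row     : row″ ≢ row
    col″≢col     : col″ ≢ col
    opposite     : T (M ⟨ row″ , col″ ⟩)

nonzeroMinor? : ∀ M x y → Dec (NonzeroMinor M x y)
nonzeroMinor? M x y = any? λ i → any? λ j → i ≢? x ×-dec j ≢? y ×-dec T? (M ⟨ i , j ⟩)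

isPermutationMatrix? : ∀ M → Dec (IsPermutationMatrix M)
isPermutationMatrix? M =
  (all? λ i → any? λ j → T? (M ⟨ i , j ⟩) ×-dec all? λ k → T? (M ⟨ i , k ⟩) →-dec k ≟ j) ×-dec
  (all? λ j → any? λ i → T? (M ⟨ i , j ⟩) ×-dec all? λ k → T? (M ⟨ k , j ⟩) →-dec k ≟ i)

k4Pattern? : ∀ M → Dec (K4Pattern M)
k4Pattern? M = map′
  (λ (r , c , rc , (r′ , r′≢r , r′c) , (c′ , c′≢c , rc′) , (r″ , c″ , r″≢r , c″≢c , r″c″)) →
     record { corner = rc ; row′≢row = r′≢r ; below = r′c ; col′≢col = c′≢c ; beside = rc′
            ; row″≢row = r″≢r ; col″≢col = c″≢c ; opposite = r″c″ })
  (λ k → let open K4Pattern k in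
     row , col , corner , (row′ , row′≢row , below) , (col′ , col′≢col , beside)
         , (row″ , col″ , row″≢row , col″≢col , opposite))
  (any? λ r → any? λ c → T? (M ⟨ r , c ⟩)
     ×-dec (any? λ r′ → r′ ≢? r ×-dec T? (M ⟨ r′ , c ⟩))
     ×-dec (any? λ c′ → c′ ≢? c ×-dec T? (M ⟨ r , c′ ⟩))
     ×-dec (any? λ r″ → any? λ c″ → r″ ≢? r ×-dec c″ ≢? c ×-dec T? (M ⟨ r″ , c″ ⟩)))

minorsNonzero⇒k4Pattern⊎permutation : ∀ M → MinorsNonzero M → K4Pattern M ⊎ IsPermutationMatrix M
minorsNonzero⇒k4Pattern⊎permutation =
  toWitness {a? = Vec-exhaustible (Vec-exhaustible Bool-exhaustible 3) 3 λ M →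
    (all? λ x → all? λ y → nonzeroMinor? M x y) →-dec (k4Pattern? M ⊎-dec isPermutationMatrix? M)} tt

module PermutationMatrix {M : Matrix₃} (perm : IsPermutationMatrix M) where

  columnOf rowOf : Fin 3 → Fin 3
  columnOf i = proj₁ (proj₁ perm i)
  rowOf j = proj₁ (proj₂ perm j)

  columnOf-rowOf : ∀ j → columnOf (rowOf j) ≡ j
  columnOf-rowOf j = sym (proj₂ (proj₂ (proj₁ perm (rowOf j))) j (proj₁ (proj₂ (proj₂ perm j))))

  rowOf-columnOf : ∀ i → rowOf (columnOf i) ≡ i
  rowOf-columnOf i = sym (proj₂ (proj₂ (proj₂ perm (columnOf i))) i (proj₁ (proj₂ (proj₁ perm i))))

  rowOf-injective : ∀ {j j′} → rowOf j ≡ rowOf j′ → j ≡ j′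
  rowOf-injective {j} {j′} eq =
    trans (sym (columnOf-rowOf j)) (trans (cong columnOf eq) (columnOf-rowOf j′))

  entry-rowOf : ∀ i j → M ⟨ i , j ⟩ ≡ ⌊ i ≟ rowOf j ⌋
  entry-rowOf i j with i ≟ rowOf j | M ⟨ i , j ⟩ in e
  ... | yes _        | true  = refl
  ... | yes refl     | false = contradiction (proj₁ (proj₂ (proj₂ perm j))) (subst T e)
  ... | no i≢rowOf-j | true  =
    contradiction (proj₂ (proj₂ (proj₂ perm j)) i (Equivalence.from T-≡ e)) i≢rowOf-j
  ... | no _         | false = refl

cliquePairAdj cliquePairCut : ∀ {m n} → (Fin m → Fin n → Bool) → Fin m ⊎ Fin n → Fin m ⊎ Fin n → Bool
cliquePairAdj H (inj₁ i) (inj₁ j) = not ⌊ i ≟ j ⌋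
cliquePairAdj H (inj₁ i) (inj₂ j) = H i j
cliquePairAdj H (inj₂ j) (inj₁ i) = H i j
cliquePairAdj H (inj₂ i) (inj₂ j) = not ⌊ i ≟ j ⌋
cliquePairCut H (inj₁ i) (inj₂ j) = H i j
cliquePairCut H (inj₂ j) (inj₁ i) = H i j
cliquePairCut H _        _        = false

injective-preserves-≟ : ∀ {n n′} (τ : Fin n → Fin n′) → Injective _≡_ _≡_ τ →
                        ∀ i j → ⌊ i ≟ j ⌋ ≡ ⌊ τ i ≟ τ j ⌋
injective-preserves-≟ τ τ-inj i j with i ≟ j | τ i ≟ τ j
... | yes _    | yes _     = refl
... | yes refl | no τi≢τi  = contradiction refl τi≢τi
... | no i≢j   | yes τi≡τj = contradiction (τ-inj τi≡τj) i≢j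
... | no _     | no _      = refl

cliquePair-relabel : ∀ {m n} {H H′ : Fin m → Fin n → Bool} (τ : Fin n → Fin n) →
  Injective _≡_ _≡_ τ → (∀ i j → H i j ≡ H′ i (τ j)) → ∀ x y →
  cliquePairAdj H x y ≡ cliquePairAdj H′ (map₂ τ x) (map₂ τ y) ×
  cliquePairCut H x y ≡ cliquePairCut H′ (map₂ τ x) (map₂ τ y)
cliquePair-relabel τ τ-inj H≡H′∘τ (inj₁ i) (inj₁ j) = refl , refl
cliquePair-relabel τ τ-inj H≡H′∘τ (inj₁ i) (inj₂ j) = H≡H′∘τ i j , H≡H′∘τ i j
cliquePair-relabel τ τ-inj H≡H′∘τ (inj₂ j) (inj₁ i) = H≡H′∘τ i j , H≡H′∘τ i j
cliquePair-relabel τ τ-inj H≡H′∘τ (inj₂ i) (inj₂ j) =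
  cong not (injective-preserves-≟ τ τ-inj i j) , refl

identity₃ : Fin 3 → Fin 3 → Bool
identity₃ i j = ⌊ i ≟ j ⌋

prism≅cliquePair-Fin6 : ∀ a b →
  prismAdj a b ≡ cliquePairAdj identity₃ (splitAt 3 a) (splitAt 3 b) ×
  prismBond a b ≡ cliquePairCut identity₃ (splitAt 3 a) (splitAt 3 b)
prism≅cliquePair-Fin6 = toWitness {a? = all? λ a → all? λ b →
  (prismAdj a b ≟ᴮ _) ×-dec (prismBond a b ≟ᴮ _)} tt

prism≅cliquePair : ∀ x y →
  prismAdj (join 3 3 x) (join 3 3 y) ≡ cliquePairAdj identity₃ x y ×
  prismBond (join 3 3 x) (join 3 3 y) ≡ cliquePairCut identity₃ x y
prism≅cliquePair x y with prism≅cliquePair-Fin6 (join 3 3 x) (join 3 3 y)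
... | agree rewrite splitAt-join 3 3 x | splitAt-join 3 3 y = agree

k4adj⇔≢ : ∀ {a b} → T (k4adj a b) ⇔ a ≢ b
k4adj⇔≢ {a} {b} with a ≟ b
... | yes a≡b = mk⇔ (λ ()) (λ a≢b → a≢b a≡b)
... | no a≢b  = mk⇔ (λ _ → a≢b) (λ _ → tt)

k4bond⇒≢ : ∀ {a b} → T (k4bond a b) → a ≢ b
k4bond⇒≢ {a} t refl = subst T (xor-same (toℕ a <ᵇ 2)) t

adjacent⇒distinct : ∀ (G : Graph) {u v} → Adj G u v → u ≢ v
adjacent⇒distinct G uv refl = contradiction (trans (sym (adj-irr G _)) uv) λ ()

module _ (G : Graph) {f : Fin 3 → Fin (n G)} (clique : ∀ {i j} → i ≢ j → Adj G (f i) (f j)) where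

  clique-injective : ∀ {i j} → f i ≡ f j → i ≡ j
  clique-injective {i} {j} fi≡fj with i ≟ j
  ... | yes i≡j = i≡j
  ... | no i≢j  = contradiction fi≡fj (adjacent⇒distinct G (clique i≢j))

  clique-adj : ∀ i j → adj G (f i) (f j) ≡ not ⌊ i ≟ j ⌋
  clique-adj i j with i ≟ j
  ... | yes refl = adj-irr G (f i)
  ... | no i≢j   = clique i≢j

module _ {G : Graph} {d : EdgeSet G} (cut : IsCut G d) where
  private
    label = proj₁ cut
    d≡δ   = proj₂ cut

  cut-sym : ∀ u v → d u v ≡ d v u
  cut-sym u v rewrite d≡δ u v | d≡δ v u | adj-sym G u v | xor-comm (label u) (label v) = refl

  cut-irreflexive : ∀ u → d u u ≡ false
  cut-irreflexive u rewrite d≡δ u u | adj-irr G u = refl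

  cut⇒adj : ∀ {u v} → d u v ≡ true → Adj G u v
  cut⇒adj {u} {v} duv = ∧-conicalˡ _ _ (trans (sym (d≡δ u v)) duv)

  cut-separates : ∀ {u v} → d u v ≡ true → label u ≢ label v
  cut-separates {u} {v} duv = xor≡true⇒≢ (∧-conicalʳ _ _ (trans (sym (d≡δ u v)) duv))

  cut-across : ∀ {u v} → label u ≢ label v → d u v ≡ adj G u v
  cut-across {u} {v} lu≢lv =
    trans (d≡δ u v) (trans (cong (adj G u v ∧_) (≢⇒xor≡true lu≢lv)) (∧-identityʳ _))

  minusD⇒same-label : ∀ {u v} → MinusD G d u v → label u ≡ label v
  minusD⇒same-label {u} {v} (adj-uv , not-cut) =
    xor≡false⇒≡ _ _ (trans (cong (_∧ (label u xor label v)) (sym adj-uv)) (trans (sym (d≡δ u v)) not-cut))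

  sameSide⇒same-label : ∀ {u v} → SameSide G d u v → label u ≡ label v
  sameSide⇒same-label = fold (λ u v → label u ≡ label v) (λ m e → trans (minusD⇒same-label m) e) refl

record TwoTriangles (G : Graph) (d : EdgeSet G) : Set where
  field
    p q   : Fin 3 → Fin (n G)
    p-adj : ∀ {i j} → i ≢ j → Adj G (p i) (p j)
    q-adj : ∀ {i j} → i ≢ j → Adj G (q i) (q j)
    p≢q   : ∀ i j → p i ≢ q j
    cover : ∀ v → (∃ λ i → p i ≡ v) ⊎ (∃ λ j → q j ≡ v)
    d-sym : ∀ u v → d u v ≡ d v u
    d-pp  : ∀ i j → d (p i) (p j) ≡ false
    d-qq  : ∀ i j → d (q i) (q j) ≡ false
    d-pq  : ∀ i j → d (p i) (q j) ≡ adj G (p i) (q j)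

  point : Fin 3 ⊎ Fin 3 → Fin (n G)
  point = [ p , q ]′

  side : Fin (n G) → Fin 3 ⊎ Fin 3
  side v = Data.Sum.map proj₁ proj₁ (cover v)

  point-side : ∀ v → point (side v) ≡ v
  point-side v with cover v
  ... | inj₁ (_ , p-i≡v) = p-i≡v
  ... | inj₂ (_ , q-j≡v) = q-j≡v

  side-point : ∀ x → side (point x) ≡ x
  side-point (inj₁ i) with cover (p i)
  ... | inj₁ (_ , p-i′≡p-i) = cong inj₁ (clique-injective G p-adj p-i′≡p-i)
  ... | inj₂ (j , q-j≡p-i)  = contradiction (sym q-j≡p-i) (p≢q i j)
  side-point (inj₂ j) with cover (q j)
  ... | inj₁ (i , p-i≡q-j)  = contradiction p-i≡q-j (p≢q i j)
  ... | inj₂ (_ , q-j′≡q-j) = cong inj₂ (clique-injective G q-adj q-j′≡q-j)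

  vertices↔ : Fin (n G) ↔ (Fin 3 ⊎ Fin 3)
  vertices↔ = mk↔ₛ′ side point side-point point-side

  vertex-elim : (P : Fin (n G) → Set) → (∀ x → P (point x)) → ∀ v → P v
  vertex-elim P P-point v = subst P (point-side v) (P-point (side v))

  crossMatrix : Matrix₃
  crossMatrix = tabulate λ i → tabulate (adj G (p i) ∘ q)

  cross-entry : ∀ i j → crossMatrix ⟨ i , j ⟩ ≡ adj G (p i) (q j)
  cross-entry i j = trans (cong (λ r → lookup r j) (lookup∘tabulate (λ i → tabulate (adj G (p i) ∘ q)) i))
                          (lookup∘tabulate (adj G (p i) ∘ q) j)

  entry⇒adj : ∀ {i j} → T (crossMatrix ⟨ i , j ⟩) → Adj G (p i) (q j)
  entry⇒adj {i} {j} t = trans (sym (cross-entry i j)) (Equivalence.to T-≡ t)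

  adj⇒entry : ∀ {i j} → Adj G (p i) (q j) → T (crossMatrix ⟨ i , j ⟩)
  adj⇒entry {i} {j} e = Equivalence.from T-≡ (trans (cross-entry i j) e)

  entry⇒cut : ∀ {i j} → T (crossMatrix ⟨ i , j ⟩) → d (p i) (q j) ≡ true
  entry⇒cut {i} {j} t = trans (d-pq i j) (entry⇒adj t)

  adj-point : ∀ x y → adj G (point x) (point y) ≡ cliquePairAdj (crossMatrix ⟨_,_⟩) x y
  adj-point (inj₁ i) (inj₁ j) = clique-adj G p-adj i j
  adj-point (inj₁ i) (inj₂ j) = sym (cross-entry i j)
  adj-point (inj₂ j) (inj₁ i) = trans (adj-sym G (q j) (p i)) (sym (cross-entry i j))
  adj-point (inj₂ i) (inj₂ j) = clique-adj G q-adj i j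

  cut-point : ∀ x y → d (point x) (point y) ≡ cliquePairCut (crossMatrix ⟨_,_⟩) x y
  cut-point (inj₁ i) (inj₁ j) = d-pp i j
  cut-point (inj₁ i) (inj₂ j) = trans (d-pq i j) (sym (cross-entry i j))
  cut-point (inj₂ j) (inj₁ i) = trans (d-sym (q j) (p i)) (trans (d-pq i j) (sym (cross-entry i j)))
  cut-point (inj₂ i) (inj₂ j) = d-qq i j

-- The right triangle is relabelled so that the cross edges become the
-- identity matching.
module SpecialPrismIso {G : Graph} {d : EdgeSet G} (F : TwoTriangles G d)
                       (perm : IsPermutationMatrix (TwoTriangles.crossMatrix F)) where
  open TwoTriangles F
  open PermutationMatrix {crossMatrix} perm
  open ≡-Reasoning

  relabel : (Fin 3 ⊎ Fin 3) ↔ (Fin 3 ⊎ Fin 3)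
  relabel = mk↔ₛ′ (map₂ rowOf) (map₂ columnOf)
                  (map₂-inverse rowOf-columnOf) (map₂-inverse columnOf-rowOf)

  prism↔ : Fin (n G) ↔ Fin 6
  prism↔ = ↔-sym +↔⊎ ↔-∘ (relabel ↔-∘ vertices↔)

  to : Fin (n G) → Fin 6
  to = Inverse.to prism↔

  Matches : Fin (n G) → Fin (n G) → Set
  Matches u v = adj G u v ≡ prismAdj (to u) (to v) × d u v ≡ prismBond (to u) (to v)

  to-point : ∀ x → to (point x) ≡ join 3 3 (map₂ rowOf x)
  to-point x = cong (join 3 3 ∘ map₂ rowOf) (side-point x)

  relabelled : ∀ x y →
    cliquePairAdj (crossMatrix ⟨_,_⟩) x y ≡ cliquePairAdj identity₃ (map₂ rowOf x) (map₂ rowOf y) ×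
    cliquePairCut (crossMatrix ⟨_,_⟩) x y ≡ cliquePairCut identity₃ (map₂ rowOf x) (map₂ rowOf y)
  relabelled = cliquePair-relabel rowOf rowOf-injective entry-rowOf

  matches : ∀ x y → Matches (point x) (point y)
  matches x y =
    (begin
      adj G (point x) (point y)                ≡⟨ adj-point x y ⟩
      cliquePairAdj (crossMatrix ⟨_,_⟩) x y    ≡⟨ proj₁ (relabelled x y) ⟩
      cliquePairAdj identity₃ x′ y′            ≡⟨ proj₁ (prism≅cliquePair x′ y′) ⟨
      prismAdj (join 3 3 x′) (join 3 3 y′)     ≡⟨ cong₂ prismAdj (to-point x) (to-point y) ⟨
      prismAdj (to (point x)) (to (point y))   ∎) ,
    (begin
      d (point x) (point y)                    ≡⟨ cut-point x y ⟩
      cliquePairCut (crossMatrix ⟨_,_⟩) x y    ≡⟨ proj₂ (relabelled x y) ⟩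
      cliquePairCut identity₃ x′ y′            ≡⟨ proj₂ (prism≅cliquePair x′ y′) ⟨
      prismBond (join 3 3 x′) (join 3 3 y′)    ≡⟨ cong₂ prismBond (to-point x) (to-point y) ⟨
      prismBond (to (point x)) (to (point y))  ∎)
    where
    x′ = map₂ rowOf x
    y′ = map₂ rowOf y

  isoSpecialPrism : IsoSpecialPrism G d
  isoSpecialPrism = prism↔ , λ u v →
    vertex-elim (λ u → Matches u v) (λ x → vertex-elim (Matches (point x)) (matches x) v) u

-- Contract the two vertices p i with i ≢ row, and the two vertices q j
-- with j ≢ col.
module SpecialK4Minor {G : Graph} {d : EdgeSet G} (F : TwoTriangles G d)
                      (k4 : K4Pattern (TwoTriangles.crossMatrix F)) where
  open TwoTriangles F
  open K4Pattern k4

  collapse : Fin 3 ⊎ Fin 3 → Fin 4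
  collapse (inj₁ i) = if does (i ≟ row) then 0F else 1F
  collapse (inj₂ j) = if does (j ≟ col) then 2F else 3F

  collapse-sides : ∀ i j → collapse (inj₁ i) ≢ collapse (inj₂ j)
  collapse-sides i j with does (i ≟ row) | does (j ≟ col)
  ... | true  | true  = λ ()
  ... | true  | false = λ ()
  ... | false | true  = λ ()
  ... | false | false = λ ()

  φ : Fin (n G) → Fin 4
  φ = collapse ∘ side

  φ-point : ∀ x → φ (point x) ≡ collapse x
  φ-point x = cong collapse (side-point x)

  φ-row : φ (p row) ≡ 0F
  φ-row = trans (φ-point (inj₁ row)) (cong (λ b → if b then 0F else 1F) (dec-true (row ≟ row) refl))

  φ-other-row : ∀ {i} → i ≢ row → φ (p i) ≡ 1F
  φ-other-row {i} i≢row = trans (φ-point (inj₁ i)) (cong (λ b → if b then 0F else 1F) (dec-false (i ≟ row) i≢row))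

  φ-col : φ (q col) ≡ 2F
  φ-col = trans (φ-point (inj₂ col)) (cong (λ b → if b then 2F else 3F) (dec-true (col ≟ col) refl))

  φ-other-col : ∀ {j} → j ≢ col → φ (q j) ≡ 3F
  φ-other-col {j} j≢col = trans (φ-point (inj₂ j)) (cong (λ b → if b then 2F else 3F) (dec-false (j ≟ col) j≢col))

  -- end a b is the endpoint in class a of the edge representing the
  -- K4 edge ab; with rep a b = (end a b , end b a), rep-sym holds by refl.
  end : Fin 4 → Fin 4 → Fin (n G)
  end 0F _  = p row
  end 1F 3F = p row″
  end 1F _  = p row′
  end 2F _  = q col
  end 3F 1F = q col″
  end 3F _  = q col′

  φ-end : ∀ a b → φ (end a b) ≡ a
  φ-end 0F _  = φ-row
  φ-end 1F 0F = φ-other-row row′≢row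
  φ-end 1F 1F = φ-other-row row′≢row
  φ-end 1F 2F = φ-other-row row′≢row
  φ-end 1F 3F = φ-other-row row″≢row
  φ-end 2F _  = φ-col
  φ-end 3F 0F = φ-other-col col′≢col
  φ-end 3F 1F = φ-other-col col″≢col
  φ-end 3F 2F = φ-other-col col′≢col
  φ-end 3F 3F = φ-other-col col′≢col

  Edge : Fin 4 → Fin 4 → Set
  Edge a b = Adj G (end a b) (end b a) × d (end a b) (end b a) ≡ k4bond a b

  flip : ∀ a b → Edge a b → Edge b a
  flip a b (adj-ab , cut-ab) =
    trans (adj-sym G _ _) adj-ab , trans (d-sym _ _) (trans cut-ab (xor-comm (toℕ a <ᵇ 2) (toℕ b <ᵇ 2)))

  edge : ∀ a b → a ≢ b → Edge a b
  edge 0F 1F _ = p-adj (≢-sym row′≢row) , d-pp row row′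
  edge 0F 2F _ = entry⇒adj corner , entry⇒cut corner
  edge 0F 3F _ = entry⇒adj beside , entry⇒cut beside
  edge 1F 2F _ = entry⇒adj below , entry⇒cut below
  edge 1F 3F _ = entry⇒adj opposite , entry⇒cut opposite
  edge 2F 3F _ = q-adj (≢-sym col′≢col) , d-qq col col′
  edge 1F 0F _ = flip 0F 1F (edge 0F 1F λ ())
  edge 2F 0F _ = flip 0F 2F (edge 0F 2F λ ())
  edge 3F 0F _ = flip 0F 3F (edge 0F 3F λ ())
  edge 2F 1F _ = flip 1F 2F (edge 1F 2F λ ())
  edge 3F 1F _ = flip 1F 3F (edge 1F 3F λ ())
  edge 3F 2F _ = flip 2F 3F (edge 2F 3F λ ())
  edge 0F 0F a≢a = contradiction refl a≢a
  edge 1F 1F a≢a = contradiction refl a≢a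
  edge 2F 2F a≢a = contradiction refl a≢a
  edge 3F 3F a≢a = contradiction refl a≢a

  Within : Fin (n G) → Fin (n G) → Fin (n G) → Set
  Within u a b = MinusD G d a b × φ a ≡ φ u × φ b ≡ φ u

  fibre-connected : ∀ x y → φ (point x) ≡ φ (point y) → Star (Within (point x)) (point x) (point y)
  fibre-connected (inj₁ i) (inj₁ j) same with i ≟ j
  ... | yes refl = ε
  ... | no i≢j   = ((p-adj i≢j , d-pp i j) , refl , sym same) ◅ ε
  fibre-connected (inj₂ i) (inj₂ j) same with i ≟ j
  ... | yes refl = ε
  ... | no i≢j   = ((q-adj i≢j , d-qq i j) , refl , sym same) ◅ ε
  fibre-connected (inj₁ i) (inj₂ j) same =
    contradiction (trans (sym (φ-point (inj₁ i))) (trans same (φ-point (inj₂ j)))) (collapse-sides i j)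
  fibre-connected (inj₂ j) (inj₁ i) same =
    contradiction (trans (sym (φ-point (inj₁ i))) (trans (sym same) (φ-point (inj₂ j)))) (collapse-sides i j)

  contraction : SpecialContraction G d
  contraction = record
    { m          = 4
    ; φ          = φ
    ; φ-surj     = λ a → end a a , φ-end a a
    ; fibre-conn = vertex-elim (λ u → ∀ v → φ u ≡ φ v → Star (Within u) u v)
                     λ x → vertex-elim _ (fibre-connected x)
    ; rep        = λ a b → end a b , end b a
    ; rep-ok     = λ a b (a≢b , _) → φ-end a b , φ-end b a , proj₁ (edge a b a≢b)
    ; rep-sym    = λ _ _ _ → refl
    }

  adjacent : ∀ {a b} → a ≢ b → SpecialContraction.Adj' contraction a b
  adjacent {a} {b} a≢b = a≢b , end a b , end b a , φ-end a b , φ-end b a , proj₁ (edge a b a≢b)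

  proper : SpecialContraction.Proper contraction
  proper with avoid-two row row′
  ... | k , k≢row , k≢row′ =
    p row′ , p k , (λ e → k≢row′ (sym (clique-injective G p-adj e))) ,
    trans (φ-other-row row′≢row) (sym (φ-other-row k≢row))

  specialK4Minor : Σ (SpecialContraction G d) λ M →
                     SpecialContraction.Proper M × SpecialContraction.IsoSpecialK4 M
  specialK4Minor = contraction , proper , ↔-id _ , λ a b →
    mk⇔ (λ (a≢b , _) → Equivalence.from k4adj⇔≢ a≢b)
        (λ t → adjacent (Equivalence.to k4adj⇔≢ t)) ,
    mk⇔ (λ ((a≢b , _) , in-cut) → Equivalence.from T-≡ (trans (sym (proj₂ (edge a b a≢b))) in-cut))
        (λ t → adjacent (k4bond⇒≢ t) , trans (proj₂ (edge a b (k4bond⇒≢ t))) (Equivalence.to T-≡ t))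

module _ {G : Graph} {d : EdgeSet G} (F : TwoTriangles G d) where
  open TwoTriangles F

  AvoidingEdge : Fin (n G) → Fin (n G) → Fin (n G) → Fin (n G) → Set
  AvoidingEdge x y a b = Adj G a b × a ≢ x × a ≢ y × b ≢ x × b ≢ y

  InP : Fin (n G) → Set
  InP v = ∃ λ i → p i ≡ v

  sameSide-stays-in-p : ∀ {a b} → SameSide G d a b → InP a → InP b
  sameSide-stays-in-p = preserved-along InP step
    where
    step : ∀ {a b} → MinusD G d a b → InP a → InP b
    step {b = b} (adj-ab , not-cut) (i , refl) with cover b
    ... | inj₁ in-p       = in-p
    ... | inj₂ (j , refl) = contradiction (trans (sym not-cut) (trans (d-pq i j) adj-ab)) λ ()

  p-q-different-sides : ∀ i j → ¬ SameSide G d (p i) (q j)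
  p-q-different-sides i j s with sameSide-stays-in-p s (i , refl)
  ... | k , p-k≡q-j = p≢q k j p-k≡q-j

  zero-minor⇒separated : ∀ {x y x′} → ¬ NonzeroMinor crossMatrix x y → x′ ≢ x →
                         ∀ y′ → ¬ Star (AvoidingEdge (p x) (q y)) (p x′) (q y′)
  zero-minor⇒separated {x} {y} {x′} zero-minor x′≢x y′ path =
    let i , _ , p-i≡q-y′ = preserved-along OffRow step path (x′ , x′≢x , refl)
    in p≢q i y′ p-i≡q-y′
    where
    OffRow : Fin (n G) → Set
    OffRow v = ∃ λ i → i ≢ x × p i ≡ v

    step : ∀ {a b} → AvoidingEdge (p x) (q y) a b → OffRow a → OffRow b
    step {b = b} (adj-ab , _ , _ , b≢p-x , b≢q-y) (i , i≢x , refl) with cover b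
    ... | inj₁ (k , refl) = k , (λ k≡x → b≢p-x (cong p k≡x)) , refl
    ... | inj₂ (k , refl) =
      contradiction (i , k , i≢x , (λ k≡y → b≢q-y (cong q k≡y)) , adj⇒entry adj-ab) zero-minor

  threeConnAlong⇒minorsNonzero : ThreeConnAlong G d → MinorsNonzero crossMatrix
  threeConnAlong⇒minorsNonzero (_ , no-separation) x y =
    decidable-stable (nonzeroMinor? crossMatrix x y) λ zero-minor →
      let x′ , x′≢x , _ = avoid-two x x
          y′ , y′≢y , _ = avoid-two y y
      in no-separation (p x , q y , p-q-different-sides x y , p x′ , q y′ ,
                        x′≢x ∘ clique-injective G p-adj , p≢q x′ y ,
                        p≢q x y′ ∘ sym , y′≢y ∘ clique-injective G q-adj ,
                        zero-minor⇒separated zero-minor x′≢x y′)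

record TriangleSide (G : Graph) (d : EdgeSet G) (w : Fin (n G)) : Set where
  field
    t      : Fin 3 → Fin (n G)
    edge   : ∀ {i j} → i ≢ j → SideEdge G d w (t i) (t j)
    closed : ∀ {a b} → SideEdge G d w a b → (∃ λ i → t i ≡ a) × (∃ λ i → t i ≡ b)

  OnTriangle : Fin (n G) → Set
  OnTriangle a = ∃ λ i → t i ≡ a

  onTriangle? : ∀ a → Dec (OnTriangle a)
  onTriangle? a = any? λ i → t i ≟ a

  t-adj : ∀ {i j} → i ≢ j → Adj G (t i) (t j)
  t-adj i≢j = proj₁ (proj₂ (edge i≢j))

  t-not-cut : ∀ {i j} → i ≢ j → d (t i) (t j) ≡ false
  t-not-cut i≢j = proj₂ (proj₂ (edge i≢j))

  t-sameSide : ∀ i → SameSide G d w (t i)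
  t-sameSide i = proj₁ (edge (≢-sym (proj₁ (proj₂ (avoid-two i i)))))

  closed-under-minusD : ∀ {a b} → OnTriangle a → MinusD G d a b → OnTriangle b
  closed-under-minusD (i , refl) ab = proj₂ (closed (t-sameSide i , ab))

  centre-on-triangle : OnTriangle w
  centre-on-triangle with ε-or-step (t-sameSide 0F)
  ... | inj₁ w≡t0 = 0F , sym w≡t0
  ... | inj₂ (_ , wc) = proj₁ (closed (ε , wc))

indexTriangle : ∀ {G d w} → SideIsTriangle G d w → TriangleSide G d w
indexTriangle {G} {d} {w} (x , y , z , x≢y , y≢z , x≢z , side⇔) =
  record { t = t ; edge = edge ; closed = closed }
  where
  t : Fin 3 → Fin (n G)
  t 0F = x
  t 1F = y
  t 2F = z

  member : ∀ i → t i ≡ x ⊎ t i ≡ y ⊎ t i ≡ z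
  member 0F = inj₁ refl
  member 1F = inj₂ (inj₁ refl)
  member 2F = inj₂ (inj₂ refl)

  index : ∀ {a} → a ≡ x ⊎ a ≡ y ⊎ a ≡ z → ∃ λ i → t i ≡ a
  index (inj₁ a≡x)        = 0F , sym a≡x
  index (inj₂ (inj₁ a≡y)) = 1F , sym a≡y
  index (inj₂ (inj₂ a≡z)) = 2F , sym a≡z

  distinct : ∀ {i j} → i ≢ j → t i ≢ t j
  distinct {0F} {1F} _ = x≢y
  distinct {0F} {2F} _ = x≢z
  distinct {1F} {0F} _ = ≢-sym x≢y
  distinct {1F} {2F} _ = y≢z
  distinct {2F} {0F} _ = ≢-sym x≢z
  distinct {2F} {1F} _ = ≢-sym y≢z
  distinct {0F} {0F} i≢i = contradiction refl i≢i
  distinct {1F} {1F} i≢i = contradiction refl i≢i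
  distinct {2F} {2F} i≢i = contradiction refl i≢i

  edge : ∀ {i j} → i ≢ j → SideEdge G d w (t i) (t j)
  edge {i} {j} i≢j = Equivalence.from (side⇔ (t i) (t j)) (distinct i≢j , member i , member j)

  closed : ∀ {a b} → SideEdge G d w a b → (∃ λ i → t i ≡ a) × (∃ λ i → t i ≡ b)
  closed {a} {b} ab with Equivalence.to (side⇔ a b) ab
  ... | _ , a∈ , b∈ = index a∈ , index b∈

-- Minimality of the bond: the edges leaving a side triangle form a nonempty
-- cut contained in d, hence equal to d.
module _ {G : Graph} {d : EdgeSet G} (bond : IsBond G d) {w} (T : TriangleSide G d w) where
  open TriangleSide T

  private
    cut : IsCut G d
    cut = proj₁ bond

    minimal = proj₂ (proj₂ bond)

    inside : Fin (n G) → Bool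
    inside a = ⌊ onTriangle? a ⌋

    inside⇒on : ∀ {a} → inside a ≡ true → OnTriangle a
    inside⇒on e = toWitness (Equivalence.from T-≡ e)

    outside⇒off : ∀ {a} → inside a ≡ false → ¬ OnTriangle a
    outside⇒off e = toWitnessFalse (Equivalence.from T-not-≡ e)

    on⇒inside : ∀ {a} → OnTriangle a → inside a ≡ true
    on⇒inside on = Equivalence.to T-≡ (fromWitness on)

    off⇒outside : ∀ {a} → ¬ OnTriangle a → inside a ≡ false
    off⇒outside off = Equivalence.to T-not-≡ (fromWitnessFalse off)

    leaving-edge-in-cut : ∀ {a b} → OnTriangle a → ¬ OnTriangle b → Adj G a b → d a b ≡ true
    leaving-edge-in-cut {a} {b} on-a off-b adj-ab with d a b in dab
    ... | true  = refl
    ... | false = contradiction (closed-under-minusD on-a (adj-ab , dab)) off-b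

    triangleCut⊆d : ∀ a b → adj G a b ∧ (inside a xor inside b) ≡ true → d a b ≡ true
    triangleCut⊆d a b e with inside a in ia | inside b in ib
    ... | true  | false = leaving-edge-in-cut (inside⇒on ia) (outside⇒off ib) (∧-conicalˡ _ _ e)
    ... | false | true  = trans (cut-sym {G} cut a b)
        (leaving-edge-in-cut (inside⇒on ib) (outside⇒off ia) (trans (adj-sym G b a) (∧-conicalˡ _ _ e)))
    ... | true  | true  = contradiction (∧-conicalʳ (adj G a b) false e) λ ()
    ... | false | false = contradiction (∧-conicalʳ (adj G a b) false e) λ ()

  cut-enters-triangle : ∀ {a₀ b₀} → d a₀ b₀ ≡ true → OnTriangle a₀ → ¬ OnTriangle b₀ →
                        ∀ {a b} → d a b ≡ true → ¬ OnTriangle a → OnTriangle b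
  cut-enters-triangle {a₀} {b₀} da₀b₀ on-a₀ off-b₀ {a} {b} dab off-a with inside b in ib
  ... | true  = inside⇒on ib
  ... | false = contradiction (∧-conicalʳ (adj G a b) false triangleCut-ab) λ ()
    where
    nonempty : NonEmptyES G (λ a b → adj G a b ∧ (inside a xor inside b))
    nonempty = a₀ , b₀ , cong₂ _∧_ (cut⇒adj {G} cut da₀b₀) (cong₂ _xor_ (on⇒inside on-a₀) (off⇒outside off-b₀))

    triangleCut-ab : adj G a b ∧ (false xor false) ≡ true
    triangleCut-ab = subst₂ (λ x y → adj G a b ∧ (x xor y) ≡ true) (off⇒outside off-a) ib
      (minimal _ (inside , λ _ _ → refl) nonempty triangleCut⊆d a b dab)

module _ {G : Graph} {d : EdgeSet G} (bond : IsBond G d) (connected : Connected G)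
         (tri : ∀ v → SideIsTriangle G d v) where
  private
    cut : IsCut G d
    cut = proj₁ bond

    label = proj₁ cut

    u₀ v₀ : Fin (n G)
    u₀ = proj₁ (proj₁ (proj₂ bond))
    v₀ = proj₁ (proj₂ (proj₁ (proj₂ bond)))

    du₀v₀ : d u₀ v₀ ≡ true
    du₀v₀ = proj₂ (proj₂ (proj₁ (proj₂ bond)))

    A : TriangleSide G d u₀
    A = indexTriangle (tri u₀)

    B : TriangleSide G d v₀
    B = indexTriangle (tri v₀)

    module A = TriangleSide A
    module B = TriangleSide B

    label-A : ∀ {a} → A.OnTriangle a → label a ≡ label u₀
    label-A (i , refl) = sym (sameSide⇒same-label {G} cut (A.t-sameSide i))

    label-B : ∀ {a} → B.OnTriangle a → label a ≡ label v₀
    label-B (j , refl) = sym (sameSide⇒same-label {G} cut (B.t-sameSide j))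

    labels-differ : label u₀ ≢ label v₀
    labels-differ = cut-separates {G} cut du₀v₀

    A-B-disjoint : ∀ {a} → A.OnTriangle a → ¬ B.OnTriangle a
    A-B-disjoint on-A on-B = labels-differ (trans (sym (label-A on-A)) (label-B on-B))

    enters-A : ∀ {a b} → d a b ≡ true → ¬ A.OnTriangle a → A.OnTriangle b
    enters-A = cut-enters-triangle bond A du₀v₀ A.centre-on-triangle
                 (λ on-A → A-B-disjoint on-A B.centre-on-triangle)

    enters-B : ∀ {a b} → d a b ≡ true → ¬ B.OnTriangle a → B.OnTriangle b
    enters-B = cut-enters-triangle bond B (trans (cut-sym {G} cut v₀ u₀) du₀v₀) B.centre-on-triangle
                 (A-B-disjoint A.centre-on-triangle)

    triangles-closed : ∀ {a b} → Adj G a b → A.OnTriangle a ⊎ B.OnTriangle a → A.OnTriangle b ⊎ B.OnTriangle b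
    triangles-closed {a} {b} adj-ab on-a with d a b in dab
    ... | false = Data.Sum.map (λ on-A → A.closed-under-minusD on-A (adj-ab , dab))
                               (λ on-B → B.closed-under-minusD on-B (adj-ab , dab)) on-a
    ... | true  = [ (λ on-A → inj₂ (enters-B dab (A-B-disjoint on-A)))
                  , (λ on-B → inj₁ (enters-A dab λ on-A → A-B-disjoint on-A on-B)) ]′ on-a

    triangle-not-cut : ∀ {w} (T : TriangleSide G d w) i j →
                       d (TriangleSide.t T i) (TriangleSide.t T j) ≡ false
    triangle-not-cut T i j with i ≟ j
    ... | yes refl = cut-irreflexive {G} cut _
    ... | no i≢j   = TriangleSide.t-not-cut T i≢j

  triangleSides⇒TwoTriangles : TwoTriangles G d
  triangleSides⇒TwoTriangles = record
    { p     = A.t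
    ; q     = B.t
    ; p-adj = A.t-adj
    ; q-adj = B.t-adj
    ; p≢q   = λ i j p-i≡q-j → A-B-disjoint (i , refl) (j , sym p-i≡q-j)
    ; cover = λ v → preserved-along _ triangles-closed (connected u₀ v) (inj₁ A.centre-on-triangle)
    ; d-sym = cut-sym {G} cut
    ; d-pp  = triangle-not-cut A
    ; d-qq  = triangle-not-cut B
    ; d-pq  = λ i j → cut-across {G} cut λ same →
                labels-differ (trans (sym (label-A (i , refl))) (trans same (label-B (j , refl))))
    }

lemma4p7 : (G : Graph) (d : EdgeSet G) →
    IsBond G d → ThreeConnAlong G d →
    (∀ v → SideIsTriangle G d v) →
    IsoSpecialPrism G d
      ⊎ Σ (SpecialContraction G d) (λ M →
          SpecialContraction.Proper M × SpecialContraction.IsoSpecialK4 M)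
lemma4p7 G d bond three-connected triangles =
  [ inj₂ ∘ SpecialK4Minor.specialK4Minor F , inj₁ ∘ SpecialPrismIso.isoSpecialPrism F ]′
    (minorsNonzero⇒k4Pattern⊎permutation (TwoTriangles.crossMatrix F) (threeConnAlong⇒minorsNonzero F three-connected))
  where
  F : TwoTriangles G d
  F = triangleSides⇒TwoTriangles bond (proj₁ (proj₂ (proj₁ three-connected))) triangles
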